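{- Let $d$ be a positive integer, $V = \{x_1,\dots,x_n\}$ a set of variables and $V' = \{x_1',\dots,x_n'\}$ a set of primed copies. Let $\rho(V,V')$ be an equational polynomial assertion $\bigwedge_{i} p_i = 0$ with $p_i \in \mathbb{Z}_{2^d}[V\cup V']$, and let $F_\rho = \{p_i\}_i$ be the set of its left-hand-side polynomials. Let $c(V)$ be any polynomial assertion in $V$, let $\eta \in \mathbb{Z}_{2^d}[V]$, and let $\eta' := \eta[x_1'/x_1,\dots,x_n'/x_n]$. If there is a constant $\mu \in \mathbb{Z}_{2^d}$ such that $\eta' - \mu\cdot\eta \in \langle F_\rho\rangle$ (the ideal of $\mathbb{Z}_{2^d}[V\cup V']$ generated by $F_\rho$), then the consecution condition holds: for every program state $\mathbf{v}$ and primed state $\mathbf{v}'$, if $\mathbf{v} \models c(V) \wedge (\eta = 0)$ and $\mathbf{v},\mathbf{v}' \models \rho(V,V')$, then $\mathbf{v}' \models (\eta' = 0)$.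
   Context: All arithmetic is in $\mathbb{Z}_{2^d}$, the ring of integers modulo $2^d$. A program state is a map $\mathbf{v}: V \to \mathbb{Z}_{2^d}$ and a primed state is a map $\mathbf{v}': V' \to \mathbb{Z}_{2^d}$. A polynomial assertion is a conjunction of relations $p \bowtie q$ between polynomials with $\bowtie \in \{=,\neq,\le,\ge,<,>\}$; an equational polynomial assertion uses only equations. $\mathbf{v}\models\phi$ (resp. $\mathbf{v},\mathbf{v}'\models\phi$) means $\phi$ is true after substituting $\mathbf{v}(x)$ for each $x\in V$ (and $\mathbf{v}'(x')$ for each $x' \in V'$). -}

module Defs where

open import Data.Nat as ℕ using (ℕ; zero; suc; _^_; NonZero)
open import Data.Nat.Properties using (m^n≢0)
open import Data.Nat.DivMod using (_mod_)
open import Data.Fin as Fin using (Fin; toℕ)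
open import Data.Sum using (_⊎_; inj₁; inj₂)
open import Data.List using (List; []; _∷_; map; foldr)
open import Data.Product using (_×_; _,_; Σ)
open import Data.Unit using (⊤)
open import Relation.Binary.PropositionalEquality using (_≡_)
open import Relation.Nullary using (¬_)

record Zmod (d : ℕ) : Set where
  constructor ⟨_⟩
  field
    val : Fin (2 ^ d)
open Zmod public

red : (d : ℕ) → ℕ → Zmod d
red d m = ⟨ _mod_ m (2 ^ d) ⦃ m^n≢0 2 d ⦄ ⟩

module _ {d : ℕ} where
  infixl 6 _+ᶻ_
  infixl 7 _*ᶻ_
  0ᶻ : Zmod d
  0ᶻ = red d 0

  1ᶻ : Zmod d
  1ᶻ = red d 1

  _+ᶻ_ : Zmod d → Zmod d → Zmod d
  a +ᶻ b = red d (toℕ (val a) ℕ.+ toℕ (val b))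

  _*ᶻ_ : Zmod d → Zmod d → Zmod d
  a *ᶻ b = red d (toℕ (val a) ℕ.* toℕ (val b))

  -ᶻ_ : Zmod d → Zmod d
  -ᶻ a = red d ((2 ^ d) ℕ.∸ toℕ (val a))

-- Polynomials ℤ_{2^d}[X] over a set of variables X: ring expressions
-- modulo the least congruence containing the commutative-ring axioms and
-- the arithmetic of constants (i.e. the free commutative ℤ_{2^d}-algebra).

infixl 6 _⊕_
infixl 7 _⊗_

data Poly (d : ℕ) (X : Set) : Set where
  var : X → Poly d X
  con : Zmod d → Poly d X
  _⊕_ : Poly d X → Poly d X → Poly d X
  _⊗_ : Poly d X → Poly d X → Poly d X
  ⊝_  : Poly d X → Poly d X

_⊖_ : ∀ {d X} → Poly d X → Poly d X → Poly d X
p ⊖ q = p ⊕ (⊝ q)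

infix 4 _≈P_
data _≈P_ {d : ℕ} {X : Set} : Poly d X → Poly d X → Set where
  ≈refl  : ∀ {p} → p ≈P p
  ≈sym   : ∀ {p q} → p ≈P q → q ≈P p
  ≈trans : ∀ {p q r} → p ≈P q → q ≈P r → p ≈P r
  ⊕-cong : ∀ {p p' q q'} → p ≈P p' → q ≈P q' → p ⊕ q ≈P p' ⊕ q'
  ⊗-cong : ∀ {p p' q q'} → p ≈P p' → q ≈P q' → p ⊗ q ≈P p' ⊗ q'
  ⊝-cong : ∀ {p p'} → p ≈P p' → ⊝ p ≈P ⊝ p'
  ⊕-assoc : ∀ p q r → (p ⊕ q) ⊕ r ≈P p ⊕ (q ⊕ r)
  ⊕-comm  : ∀ p q → p ⊕ q ≈P q ⊕ p
  ⊕-idˡ   : ∀ p → con 0ᶻ ⊕ p ≈P p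
  ⊝-invˡ  : ∀ p → (⊝ p) ⊕ p ≈P con 0ᶻ
  ⊗-assoc : ∀ p q r → (p ⊗ q) ⊗ r ≈P p ⊗ (q ⊗ r)
  ⊗-comm  : ∀ p q → p ⊗ q ≈P q ⊗ p
  ⊗-idˡ   : ∀ p → con 1ᶻ ⊗ p ≈P p
  distribˡ : ∀ p q r → p ⊗ (q ⊕ r) ≈P (p ⊗ q) ⊕ (p ⊗ r)
  con-+ : ∀ a b → con a ⊕ con b ≈P con (a +ᶻ b)
  con-* : ∀ a b → con a ⊗ con b ≈P con (a *ᶻ b)
  con-- : ∀ a → ⊝ con a ≈P con (-ᶻ a)

rename : ∀ {d X Y} → (X → Y) → Poly d X → Poly d Y
rename f (var x) = var (f x)
rename f (con a) = con a
rename f (p ⊕ q) = rename f p ⊕ rename f q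
rename f (p ⊗ q) = rename f p ⊗ rename f q
rename f (⊝ p)   = ⊝ rename f p

eval : ∀ {d X} → (X → Zmod d) → Poly d X → Zmod d
eval v (var x) = v x
eval v (con a) = a
eval v (p ⊕ q) = eval v p +ᶻ eval v q
eval v (p ⊗ q) = eval v p *ᶻ eval v q
eval v (⊝ p)   = -ᶻ eval v p

-- Ideal generated by a finite set of polynomials F:
-- f ∈ ⟨F⟩ iff f = Σ qᵢ pᵢ in the polynomial ring for some cofactors qᵢ.

linComb : ∀ {d X} → List (Poly d X × Poly d X) → Poly d X
linComb = foldr (λ { (q , p) acc → q ⊗ p ⊕ acc }) (con 0ᶻ)

cofactorsOf : ∀ {d X} → List (Poly d X × Poly d X) → List (Poly d X)
cofactorsOf = map (λ { (q , p) → p })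

InIdeal : ∀ {d X} → List (Poly d X) → Poly d X → Set
InIdeal {d} {X} F f =
  Σ (List (Poly d X × Poly d X)) λ qps → (cofactorsOf qps ≡ F) × (f ≈P linComb qps)

-- Polynomial assertions; order relations compare canonical
-- representatives in {0,…,2^d-1}.

data Rel : Set where
  `= `≠ `≤ `≥ `< `> : Rel

record Atom (d : ℕ) (X : Set) : Set where
  constructor atom
  field
    lhs : Poly d X
    rel : Rel
    rhs : Poly d X

Assertion : ℕ → Set → Set
Assertion d X = List (Atom d X)

⟦_⟧ᴿ : ∀ {d} → Rel → Zmod d → Zmod d → Set
⟦ `= ⟧ᴿ a b = a ≡ b
⟦ `≠ ⟧ᴿ a b = ¬ (a ≡ b)
⟦ `≤ ⟧ᴿ a b = toℕ (val a) ℕ.≤ toℕ (val b)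
⟦ `≥ ⟧ᴿ a b = toℕ (val a) ℕ.≥ toℕ (val b)
⟦ `< ⟧ᴿ a b = toℕ (val a) ℕ.< toℕ (val b)
⟦ `> ⟧ᴿ a b = toℕ (val a) ℕ.> toℕ (val b)

infix 4 _⊨_
_⊨_ : ∀ {d X} → (X → Zmod d) → Assertion d X → Set
v ⊨ [] = ⊤
v ⊨ (atom p r q ∷ φ) = ⟦ r ⟧ᴿ (eval v p) (eval v q) × (v ⊨ φ)

eqAssertion : ∀ {d X} → List (Poly d X) → Assertion d X
eqAssertion = map (λ p → atom p `= (con 0ᶻ))

-- Variables V = {x₁..xₙ} ↦ inj₁ i, primed V' = {x₁'..xₙ'} ↦ inj₂ i.

VV' : ℕ → Set
VV' n = Fin n ⊎ Fin n

_∪ˢ_ : ∀ {d n} → (Fin n → Zmod d) → (Fin n → Zmod d) → VV' n → Zmod d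
(v ∪ˢ v') (inj₁ i) = v i
(v ∪ˢ v') (inj₂ i) = v' i

unprimed : ∀ {d n} → Poly d (Fin n) → Poly d (VV' n)
unprimed = rename inj₁

primed : ∀ {d n} → Poly d (Fin n) → Poly d (VV' n)
primed = rename inj₂

{-# OPTIONS --safe #-}
module Submission where

-- A polynomial in the ideal ⟨Fρ⟩ vanishes at every common zero of Fρ, in
-- particular at any pair of states satisfying ρ.  So η(v') − μ·η(v) = 0, and
-- η(v) = 0 forces η(v') = 0.  The only work is checking that evaluation
-- respects the congruence ≈P, i.e. that ℤ_{2^d} is a commutative ring; this
-- is inherited from ℕ through the surjective homomorphism m ↦ m mod 2^d.

open import Defs
open import Data.Nat using (ℕ; _≤_; _+_; _*_; _∸_; _^_; _%_; NonZero)
open import Data.Nat.Properties using (m^n≢0; +-comm; +-assoc; *-comm; *-assoc; *-identityˡ; *-zeroʳ; *-distribˡ-+; m∸n+n≡m; <⇒≤)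
open import Data.Nat.DivMod using (m%n<n; %-distribˡ-+; %-distribˡ-*; [m+n]%n≡m%n; m<n⇒m%n≡m)
open import Data.Fin using (Fin; toℕ)
open import Data.Fin.Properties using (toℕ-injective; toℕ-fromℕ<; toℕ<n)
open import Data.List using (List; _∷_; [])
open import Data.Product using (Σ; _,_)
open import Data.Sum using (inj₁; inj₂)
open import Relation.Binary.PropositionalEquality using (_≡_; refl; sym; trans; cong; cong₂; module ≡-Reasoning)
open ≡-Reasoning

module _ {d : ℕ} where

  private
    instance
      2^d≢0 : NonZero (2 ^ d)
      2^d≢0 = m^n≢0 2 d

  toℕᶻ : Zmod d → ℕ
  toℕᶻ a = toℕ (val a)

  toℕᶻ-red : ∀ m → toℕᶻ (red d m) ≡ m % 2 ^ d
  toℕᶻ-red m = toℕ-fromℕ< (m%n<n m (2 ^ d))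

  red-cong-% : ∀ {m k} → m % 2 ^ d ≡ k % 2 ^ d → red d m ≡ red d k
  red-cong-% {m} {k} m≡k = cong ⟨_⟩ (toℕ-injective (begin
    toℕᶻ (red d m) ≡⟨ toℕᶻ-red m ⟩
    m % 2 ^ d      ≡⟨ m≡k ⟩
    k % 2 ^ d      ≡⟨ toℕᶻ-red k ⟨
    toℕᶻ (red d k) ∎))

  red-toℕᶻ : ∀ a → red d (toℕᶻ a) ≡ a
  red-toℕᶻ a = cong ⟨_⟩ (toℕ-injective (trans (toℕᶻ-red (toℕᶻ a)) (m<n⇒m%n≡m (toℕ<n (val a)))))

  red-+ : ∀ m k → red d m +ᶻ red d k ≡ red d (m + k)
  red-+ m k = red-cong-% (begin
    (toℕᶻ (red d m) + toℕᶻ (red d k)) % 2 ^ d ≡⟨ cong₂ (λ s t → (s + t) % 2 ^ d) (toℕᶻ-red m) (toℕᶻ-red k) ⟩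
    (m % 2 ^ d + k % 2 ^ d) % 2 ^ d           ≡⟨ %-distribˡ-+ m k (2 ^ d) ⟨
    (m + k) % 2 ^ d                           ∎)

  red-* : ∀ m k → red d m *ᶻ red d k ≡ red d (m * k)
  red-* m k = red-cong-% (begin
    (toℕᶻ (red d m) * toℕᶻ (red d k)) % 2 ^ d ≡⟨ cong₂ (λ s t → (s * t) % 2 ^ d) (toℕᶻ-red m) (toℕᶻ-red k) ⟩
    (m % 2 ^ d * (k % 2 ^ d)) % 2 ^ d         ≡⟨ %-distribˡ-* m k (2 ^ d) ⟨
    (m * k) % 2 ^ d                           ∎)

  +ᶻ-comm : ∀ a b → a +ᶻ b ≡ b +ᶻ a
  +ᶻ-comm a b = cong (red d) (+-comm (toℕᶻ a) (toℕᶻ b))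

  *ᶻ-comm : ∀ a b → a *ᶻ b ≡ b *ᶻ a
  *ᶻ-comm a b = cong (red d) (*-comm (toℕᶻ a) (toℕᶻ b))

  +ᶻ-assoc : ∀ a b c → (a +ᶻ b) +ᶻ c ≡ a +ᶻ (b +ᶻ c)
  +ᶻ-assoc a b c = begin
    red d (x + y) +ᶻ c          ≡⟨ cong (red d (x + y) +ᶻ_) (red-toℕᶻ c) ⟨
    red d (x + y) +ᶻ red d z    ≡⟨ red-+ (x + y) z ⟩
    red d (x + y + z)           ≡⟨ cong (red d) (+-assoc x y z) ⟩
    red d (x + (y + z))         ≡⟨ red-+ x (y + z) ⟨
    red d x +ᶻ red d (y + z)    ≡⟨ cong (_+ᶻ red d (y + z)) (red-toℕᶻ a) ⟩
    a +ᶻ (b +ᶻ c)               ∎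
    where x = toℕᶻ a ; y = toℕᶻ b ; z = toℕᶻ c

  *ᶻ-assoc : ∀ a b c → (a *ᶻ b) *ᶻ c ≡ a *ᶻ (b *ᶻ c)
  *ᶻ-assoc a b c = begin
    red d (x * y) *ᶻ c          ≡⟨ cong (red d (x * y) *ᶻ_) (red-toℕᶻ c) ⟨
    red d (x * y) *ᶻ red d z    ≡⟨ red-* (x * y) z ⟩
    red d (x * y * z)           ≡⟨ cong (red d) (*-assoc x y z) ⟩
    red d (x * (y * z))         ≡⟨ red-* x (y * z) ⟨
    red d x *ᶻ red d (y * z)    ≡⟨ cong (_*ᶻ red d (y * z)) (red-toℕᶻ a) ⟩
    a *ᶻ (b *ᶻ c)               ∎
    where x = toℕᶻ a ; y = toℕᶻ b ; z = toℕᶻ c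

  *ᶻ-distribˡ-+ᶻ : ∀ a b c → a *ᶻ (b +ᶻ c) ≡ a *ᶻ b +ᶻ a *ᶻ c
  *ᶻ-distribˡ-+ᶻ a b c = begin
    a *ᶻ red d (y + z)          ≡⟨ cong (_*ᶻ red d (y + z)) (red-toℕᶻ a) ⟨
    red d x *ᶻ red d (y + z)    ≡⟨ red-* x (y + z) ⟩
    red d (x * (y + z))         ≡⟨ cong (red d) (*-distribˡ-+ x y z) ⟩
    red d (x * y + x * z)       ≡⟨ red-+ (x * y) (x * z) ⟨
    a *ᶻ b +ᶻ a *ᶻ c            ∎
    where x = toℕᶻ a ; y = toℕᶻ b ; z = toℕᶻ c

  +ᶻ-identityˡ : ∀ a → 0ᶻ +ᶻ a ≡ a
  +ᶻ-identityˡ a = begin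
    0ᶻ +ᶻ a                     ≡⟨ cong (0ᶻ +ᶻ_) (red-toℕᶻ a) ⟨
    red d 0 +ᶻ red d (toℕᶻ a)   ≡⟨ red-+ 0 (toℕᶻ a) ⟩
    red d (toℕᶻ a)              ≡⟨ red-toℕᶻ a ⟩
    a                           ∎

  +ᶻ-identityʳ : ∀ a → a +ᶻ 0ᶻ ≡ a
  +ᶻ-identityʳ a = trans (+ᶻ-comm a 0ᶻ) (+ᶻ-identityˡ a)

  *ᶻ-identityˡ : ∀ a → 1ᶻ *ᶻ a ≡ a
  *ᶻ-identityˡ a = begin
    1ᶻ *ᶻ a                     ≡⟨ cong (1ᶻ *ᶻ_) (red-toℕᶻ a) ⟨
    red d 1 *ᶻ red d (toℕᶻ a)   ≡⟨ red-* 1 (toℕᶻ a) ⟩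
    red d (1 * toℕᶻ a)          ≡⟨ cong (red d) (*-identityˡ (toℕᶻ a)) ⟩
    red d (toℕᶻ a)              ≡⟨ red-toℕᶻ a ⟩
    a                           ∎

  *ᶻ-zeroʳ : ∀ a → a *ᶻ 0ᶻ ≡ 0ᶻ
  *ᶻ-zeroʳ a = begin
    a *ᶻ red d 0                ≡⟨ cong (_*ᶻ red d 0) (red-toℕᶻ a) ⟨
    red d (toℕᶻ a) *ᶻ red d 0   ≡⟨ red-* (toℕᶻ a) 0 ⟩
    red d (toℕᶻ a * 0)          ≡⟨ cong (red d) (*-zeroʳ (toℕᶻ a)) ⟩
    0ᶻ                          ∎

  -ᶻ-inverseˡ : ∀ a → -ᶻ a +ᶻ a ≡ 0ᶻ
  -ᶻ-inverseˡ a = begin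
    red d (2 ^ d ∸ x) +ᶻ a        ≡⟨ cong (red d (2 ^ d ∸ x) +ᶻ_) (red-toℕᶻ a) ⟨
    red d (2 ^ d ∸ x) +ᶻ red d x  ≡⟨ red-+ (2 ^ d ∸ x) x ⟩
    red d (2 ^ d ∸ x + x)         ≡⟨ cong (red d) (m∸n+n≡m (<⇒≤ (toℕ<n (val a)))) ⟩
    red d (2 ^ d)                 ≡⟨ red-cong-% ([m+n]%n≡m%n 0 (2 ^ d)) ⟩
    0ᶻ                            ∎
    where x = toℕᶻ a

  -ᶻ-zero : -ᶻ 0ᶻ {d} ≡ 0ᶻ
  -ᶻ-zero = trans (sym (+ᶻ-identityʳ (-ᶻ 0ᶻ))) (-ᶻ-inverseˡ 0ᶻ)

  y-μx≡0⇒x≡0⇒y≡0 : ∀ {x y : Zmod d} μ → y +ᶻ -ᶻ (μ *ᶻ x) ≡ 0ᶻ → x ≡ 0ᶻ → y ≡ 0ᶻ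
  y-μx≡0⇒x≡0⇒y≡0 {y = y} μ y-μx≡0 refl = begin
    y                      ≡⟨ +ᶻ-identityʳ y ⟨
    y +ᶻ 0ᶻ                ≡⟨ cong (y +ᶻ_) (trans (cong -ᶻ_ (*ᶻ-zeroʳ μ)) -ᶻ-zero) ⟨
    y +ᶻ -ᶻ (μ *ᶻ 0ᶻ)      ≡⟨ y-μx≡0 ⟩
    0ᶻ                     ∎

module _ {d : ℕ} {X : Set} where

  eval-cong : ∀ (w : X → Zmod d) {p q} → p ≈P q → eval w p ≡ eval w q
  eval-cong w ≈refl               = refl
  eval-cong w (≈sym p≈q)          = sym (eval-cong w p≈q)
  eval-cong w (≈trans p≈q q≈r)    = trans (eval-cong w p≈q) (eval-cong w q≈r)
  eval-cong w (⊕-cong p≈p' q≈q')  = cong₂ _+ᶻ_ (eval-cong w p≈p') (eval-cong w q≈q')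
  eval-cong w (⊗-cong p≈p' q≈q')  = cong₂ _*ᶻ_ (eval-cong w p≈p') (eval-cong w q≈q')
  eval-cong w (⊝-cong p≈p')       = cong -ᶻ_ (eval-cong w p≈p')
  eval-cong w (⊕-assoc p q r)     = +ᶻ-assoc (eval w p) (eval w q) (eval w r)
  eval-cong w (⊕-comm p q)        = +ᶻ-comm (eval w p) (eval w q)
  eval-cong w (⊕-idˡ p)           = +ᶻ-identityˡ (eval w p)
  eval-cong w (⊝-invˡ p)          = -ᶻ-inverseˡ (eval w p)
  eval-cong w (⊗-assoc p q r)     = *ᶻ-assoc (eval w p) (eval w q) (eval w r)
  eval-cong w (⊗-comm p q)        = *ᶻ-comm (eval w p) (eval w q)
  eval-cong w (⊗-idˡ p)           = *ᶻ-identityˡ (eval w p)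
  eval-cong w (distribˡ p q r)    = *ᶻ-distribˡ-+ᶻ (eval w p) (eval w q) (eval w r)
  eval-cong w (con-+ a b)         = refl
  eval-cong w (con-* a b)         = refl
  eval-cong w (con-- a)           = refl

  eval-rename : ∀ {Y : Set} (f : Y → X) (w : X → Zmod d) p → eval w (rename f p) ≡ eval (λ y → w (f y)) p
  eval-rename f w (var y) = refl
  eval-rename f w (con a) = refl
  eval-rename f w (p ⊕ q) = cong₂ _+ᶻ_ (eval-rename f w p) (eval-rename f w q)
  eval-rename f w (p ⊗ q) = cong₂ _*ᶻ_ (eval-rename f w p) (eval-rename f w q)
  eval-rename f w (⊝ p)   = cong -ᶻ_ (eval-rename f w p)

  linComb-vanishes : ∀ (w : X → Zmod d) qps → w ⊨ eqAssertion (cofactorsOf qps) → eval w (linComb qps) ≡ 0ᶻ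
  linComb-vanishes w []               _            = refl
  linComb-vanishes w ((q , p) ∷ qps) (p≡0 , rest) = begin
    eval w q *ᶻ eval w p +ᶻ eval w (linComb qps) ≡⟨ cong₂ (λ s t → eval w q *ᶻ s +ᶻ t) p≡0 (linComb-vanishes w qps rest) ⟩
    eval w q *ᶻ 0ᶻ +ᶻ 0ᶻ                         ≡⟨ +ᶻ-identityʳ _ ⟩
    eval w q *ᶻ 0ᶻ                               ≡⟨ *ᶻ-zeroʳ (eval w q) ⟩
    0ᶻ                                           ∎

  InIdeal-vanishes : ∀ {F f} (w : X → Zmod d) → InIdeal F f → w ⊨ eqAssertion F → eval w f ≡ 0ᶻ
  InIdeal-vanishes w (qps , refl , f≈Σqp) w⊨F = trans (eval-cong w f≈Σqp) (linComb-vanishes w qps w⊨F)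

proposition4 : (d : ℕ) → 1 ≤ d → (n : ℕ)
    → (Fρ : List (Poly d (VV' n)))
    → (c : Assertion d (Fin n))
    → (η : Poly d (Fin n))
    → Σ (Zmod d) (λ μ → InIdeal Fρ (primed η ⊖ (con μ ⊗ unprimed η)))
    → (v v' : Fin n → Zmod d)
    → v ⊨ c → v ⊨ (atom η `= (con 0ᶻ) ∷ [])
    → (v ∪ˢ v') ⊨ eqAssertion Fρ
    → v' ⊨ (atom η `= (con 0ᶻ) ∷ [])
proposition4 d _ n Fρ c η (μ , η'-μη∈⟨Fρ⟩) v v' _ (η[v]≡0 , _) v,v'⊨ρ =
  y-μx≡0⇒x≡0⇒y≡0 μ η[v']-μη[v]≡0 η[v]≡0 , _
  where
    w = v ∪ˢ v'
    η[v']-μη[v]≡0 : eval v' η +ᶻ -ᶻ (μ *ᶻ eval v η) ≡ 0ᶻ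
    η[v']-μη[v]≡0 = begin
      eval v' η +ᶻ -ᶻ (μ *ᶻ eval v η)             ≡⟨ cong₂ (λ s t → s +ᶻ -ᶻ (μ *ᶻ t)) (eval-rename inj₂ w η) (eval-rename inj₁ w η) ⟨
      eval w (primed η ⊖ (con μ ⊗ unprimed η))    ≡⟨ InIdeal-vanishes w η'-μη∈⟨Fρ⟩ v,v'⊨ρ ⟩
      0ᶻ                                          ∎
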